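{- Let $n,m$ be positive integers. If some graph $G$ on $n$ vertices has a fooling set of size $m$, then $\mathbf{bp}_{or}(K_m)\le n$.
   Context: For a graph $G$, a fooling set is a set $\mathcal C$ of pairs $(K,S)$ where $K$ is a clique and $S$ a stable set of $G$ (possibly empty) with $K\cap S=\emptyset$, such that for any two distinct pairs $(K,S),(K',S')\in\mathcal C$, $K\cap S'\neq\emptyset$ or $K'\cap S\neq\emptyset$. $K_m$ is the complete graph on $m$ vertices. The oriented bipartite packing $\mathbf{bp}_{or}(H)$ of an undirected graph $H$ is the minimum $k$ such that there exist pairs $(A_1,B_1),\dots,(A_k,B_k)$ of disjoint vertex subsets with every vertex of $A_i$ adjacent to every vertex of $B_i$, such that every edge $xy$ satisfies $x\in A_i,y\in B_i$ or $y\in A_i,x\in B_i$ for some $i$, and there is no ordered pair $(x,y)$ and distinct $i\neq j$ with $x\in A_i\cap A_j$ and $y\in B_i\cap B_j$. -}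

module Defs where

open import Data.Nat using (ℕ; _≤_)
open import Data.Fin using (Fin)
open import Data.Fin.Subset using (Subset; _∈_; _∉_)
open import Data.Product using (Σ; ∃; _×_; _,_)
open import Data.Sum using (_⊎_)
open import Relation.Nullary using (¬_)
open import Relation.Binary.PropositionalEquality using (_≡_; _≢_)
open import Level using (0ℓ; suc)

record Graph (n : ℕ) : Set₁ where
  field
    Adj    : Fin n → Fin n → Set
    sym    : ∀ {x y} → Adj x y → Adj y x
    irrefl : ∀ {x} → ¬ Adj x x
open Graph public

K : (m : ℕ) → Graph m
K m = record
  { Adj    = λ x y → x ≢ y
  ; sym    = λ x≢y y≡x → x≢y (Relation.Binary.PropositionalEquality.sym y≡x)
  ; irrefl = λ x≢x → x≢x Relation.Binary.PropositionalEquality.refl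
  }

module _ {n : ℕ} (G : Graph n) where

  IsClique : Subset n → Set
  IsClique C = ∀ {x y} → x ∈ C → y ∈ C → x ≢ y → Adj G x y

  IsStable : Subset n → Set
  IsStable S = ∀ {x y} → x ∈ S → y ∈ S → ¬ Adj G x y

  Disjoint : Subset n → Subset n → Set
  Disjoint A B = ∀ {x} → x ∈ A → x ∉ B

  Meets : Subset n → Subset n → Set
  Meets A B = ∃ λ x → x ∈ A × x ∈ B

  -- A fooling set of size m: m pairs (K i, S i), indexed by Fin m.
  -- The cross condition for i ≢ j forces the pairs to be pairwise distinct,
  -- so the set has exactly m elements.
  record FoolingSet (m : ℕ) : Set where
    field
      Kl       : Fin m → Subset n
      St       : Fin m → Subset n
      clique   : ∀ i → IsClique (Kl i)
      stable   : ∀ i → IsStable (St i)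
      disjoint : ∀ i → Disjoint (Kl i) (St i)
      fooling  : ∀ i j → i ≢ j → Meets (Kl i) (St j) ⊎ Meets (Kl j) (St i)

  record OrBipartitePacking (k : ℕ) : Set where
    field
      A B       : Fin k → Subset n
      disjoint  : ∀ i → Disjoint (A i) (B i)
      complete  : ∀ i {x y} → x ∈ A i → y ∈ B i → Adj G x y
      covers    : ∀ {x y} → Adj G x y →
                  ∃ λ i → (x ∈ A i × y ∈ B i) ⊎ (y ∈ A i × x ∈ B i)
      oriented  : ∀ i j → i ≢ j → ∀ x y →
                  ¬ ((x ∈ A i × x ∈ A j) × (y ∈ B i × y ∈ B j))

  bpOr≤ : ℕ → Set
  bpOr≤ k = ∃ λ k′ → k′ ≤ k × OrBipartitePacking k′

-- Transpose the fooling set: each vertex v of G yields the pair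
-- A v = {i ∣ v ∈ K i}, B v = {i ∣ v ∈ S i} of vertex sets of K_m.
-- Disjointness of K i and S i keeps A v × B v off the diagonal, so it is
-- complete bipartite in K_m; the fooling condition says every edge of K_m is
-- covered by some v; and two vertices v ≠ w lying in a common K i and a
-- common S j would be both adjacent (K i is a clique) and non-adjacent (S j is
-- stable), so the packing is oriented.
module Submission where

open import Defs
open import Data.Nat using (ℕ; _≤_)
open import Data.Nat.Properties using (≤-refl)
open import Data.Fin using (Fin)
open import Data.Fin.Subset using (Subset; _∈_)
open import Data.Vec using (lookup; tabulate)
open import Data.Vec.Properties using ([]=⇒lookup; lookup⇒[]=; lookup∘tabulate)
open import Data.Product using (∃; _×_; _,_)
open import Data.Sum using (_⊎_; inj₁; inj₂)
open import Relation.Binary.PropositionalEquality using (_≢_; refl; trans)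
  renaming (sym to ≡-sym)
open import Relation.Nullary using (¬_)

transpose : ∀ {m n} → (Fin m → Subset n) → Fin n → Subset m
transpose S v = tabulate λ i → lookup (S i) v

module _ {m n} (S : Fin m → Subset n) {i : Fin m} {v : Fin n} where

  ∈-transpose⁺ : v ∈ S i → i ∈ transpose S v
  ∈-transpose⁺ v∈Si = lookup⇒[]= i (transpose S v)
    (trans (lookup∘tabulate (λ j → lookup (S j) v) i) ([]=⇒lookup v∈Si))

  ∈-transpose⁻ : i ∈ transpose S v → v ∈ S i
  ∈-transpose⁻ i∈Sᵀv = lookup⇒[]= v (S i)
    (trans (≡-sym (lookup∘tabulate (λ j → lookup (S j) v) i)) ([]=⇒lookup i∈Sᵀv))

module _ {n m} {G : Graph n} (F : FoolingSet G m) where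
  open FoolingSet F

  A B : Fin n → Subset m
  A = transpose Kl
  B = transpose St

  A∩B≡∅ : ∀ v {i} → i ∈ A v → ¬ i ∈ B v
  A∩B≡∅ v {i} i∈Av i∈Bv = disjoint i (∈-transpose⁻ Kl i∈Av) (∈-transpose⁻ St i∈Bv)

  A×B-complete : ∀ v {i j} → i ∈ A v → j ∈ B v → i ≢ j
  A×B-complete v i∈Av j∈Bv refl = A∩B≡∅ v i∈Av j∈Bv

  A×B-covers : ∀ {i j} → i ≢ j → ∃ λ v → (i ∈ A v × j ∈ B v) ⊎ (j ∈ A v × i ∈ B v)
  A×B-covers {i} {j} i≢j with fooling i j i≢j
  ... | inj₁ (v , v∈Ki , v∈Sj) = v , inj₁ (∈-transpose⁺ Kl v∈Ki , ∈-transpose⁺ St v∈Sj)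
  ... | inj₂ (v , v∈Kj , v∈Si) = v , inj₂ (∈-transpose⁺ Kl v∈Kj , ∈-transpose⁺ St v∈Si)

  A×B-oriented : ∀ v w → v ≢ w → ∀ i j →
                 ¬ ((i ∈ A v × i ∈ A w) × (j ∈ B v × j ∈ B w))
  A×B-oriented v w v≢w i j ((i∈Av , i∈Aw) , (j∈Bv , j∈Bw)) =
    stable j (∈-transpose⁻ St j∈Bv) (∈-transpose⁻ St j∈Bw)
      (clique i (∈-transpose⁻ Kl i∈Av) (∈-transpose⁻ Kl i∈Aw) v≢w)

  foolingSet⇒orBipartitePacking : OrBipartitePacking (K m) n
  foolingSet⇒orBipartitePacking = record
    { A        = A
    ; B        = B
    ; disjoint = A∩B≡∅
    ; complete = A×B-complete
    ; covers   = A×B-covers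
    ; oriented = A×B-oriented
    }

lemma15 : (n m : ℕ) → 1 ≤ n → 1 ≤ m → (G : Graph n) →
          FoolingSet G m → bpOr≤ (K m) n
lemma15 n m _ _ G F = n , ≤-refl , foolingSet⇒orBipartitePacking F
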